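{- Let $e \geq 3$ be an integer and $1 \leq r \leq e-2$. Suppose there is an integral convex polytope $\mathcal{P}$ of dimension $e$ such that the coefficient of $n^r$ in $i(\mathcal{P},n)$ is negative and all the other coefficients of $i(\mathcal{P},n)$ are positive. Then there exists an integral convex polytope $\mathcal{P}'$ of dimension $e+1$ such that the coefficient of $n^{r+1}$ in $i(\mathcal{P}',n)$ is negative and all the other coefficients of $i(\mathcal{P}',n)$ are positive.
   Context: A convex polytope $\mathcal{P} \subset \mathbb{R}^N$ is integral if all its vertices have integer coordinates. For an integral convex polytope $\mathcal{P}$ of dimension $d$, the Ehrhart polynomial $i(\mathcal{P},n)$ is the polynomial in $n$ (of degree $d$ with constant term $1$) satisfying $i(\mathcal{P},n) = \#(n\mathcal{P} \cap \mathbb{Z}^N)$ for all positive integers $n$, where $n\mathcal{P} = \{n\alpha : \alpha \in \mathcal{P}\}$. -}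

module Defs where

open import Data.Nat using (ℕ; zero; suc)
open import Data.Integer using (ℤ; +_)
open import Data.Rational using (ℚ; 0ℚ; 1ℚ; _+_; _*_; _/_; _<_; _≤_)
open import Data.Fin using (Fin; zero; suc; toℕ)
open import Data.Vec using (Vec; lookup)
open import Data.List using (List; length)
open import Data.List.Membership.Propositional using (_∈_)
open import Data.List.Relation.Unary.Unique.Propositional using (Unique)
open import Data.Product using (Σ; ∃; _×_)
open import Function.Bundles using (_⇔_)
open import Relation.Binary.PropositionalEquality using (_≡_; _≢_)

ℤ→ℚ : ℤ → ℚ
ℤ→ℚ z = z / 1

ℕ→ℚ : ℕ → ℚ
ℕ→ℚ n = (+ n) / 1

Σℚ : (m : ℕ) → (Fin m → ℚ) → ℚ
Σℚ zero f = 0ℚ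
Σℚ (suc m) f = f zero + Σℚ m (λ i → f (suc i))

_^ℚ_ : ℚ → ℕ → ℚ
q ^ℚ zero = 1ℚ
q ^ℚ suc k = q * (q ^ℚ k)

Point : ℕ → Set
Point N = Vec ℤ N

-- An integral convex polytope in ℝ^N is represented as the convex hull of a
-- finite family V : Fin m → ℤ^N of lattice points (e.g. its vertices).

Convex : (m : ℕ) → (Fin m → ℚ) → Set
Convex m λc = (∀ i → 0ℚ ≤ λc i) × (Σℚ m λc ≡ 1ℚ)

InHull : {N m : ℕ} → (Fin m → Point N) → (Fin N → ℚ) → Set
InHull {N} {m} V y =
  Σ (Fin m → ℚ) λ λc → Convex m λc ×
    (∀ (j : Fin N) → y j ≡ Σℚ m (λ i → λc i * ℤ→ℚ (lookup (V i) j)))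

InDilate : {N m : ℕ} → (Fin m → Point N) → ℕ → Point N → Set
InDilate {N} V n x =
  Σ (Fin N → ℚ) λ y → InHull V y × (∀ (j : Fin N) → ℤ→ℚ (lookup x j) ≡ ℕ→ℚ n * y j)

HasCard : {N : ℕ} → (Point N → Set) → ℕ → Set
HasCard {N} S k =
  Σ (List (Point N)) λ L → (length L ≡ k) × Unique L × (∀ x → (x ∈ L) ⇔ S x)

-- points w : Fin (suc k) → ℤ^N are affinely independent over ℚ (equivalently ℝ)
AffIndep : {N k : ℕ} → (Fin (suc k) → Point N) → Set
AffIndep {N} {k} w =
  ∀ (μ : Fin (suc k) → ℚ) →
    Σℚ (suc k) μ ≡ 0ℚ →
    (∀ (j : Fin N) → Σℚ (suc k) (λ i → μ i * ℤ→ℚ (lookup (w i) j)) ≡ 0ℚ) →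
    ∀ i → μ i ≡ 0ℚ

HasDim : {N m : ℕ} → (Fin m → Point N) → ℕ → Set
HasDim {N} {m} V d =
  (Σ (Fin (suc d) → Fin m) λ ι → AffIndep (λ i → V (ι i))) ×
  (∀ (ι : Fin (suc (suc d)) → Fin m) → AffIndep (λ i → V (ι i)) → ⊥')
  where
    open import Data.Empty renaming (⊥ to ⊥')

evalPoly : {d : ℕ} → Vec ℚ (suc d) → ℚ → ℚ
evalPoly {d} c x = Σℚ (suc d) (λ i → lookup c i * (x ^ℚ toℕ i))

IsEhrhartPoly : {N m d : ℕ} → (Fin m → Point N) → Vec ℚ (suc d) → Set
IsEhrhartPoly V c =
  ∀ (n : ℕ) → 1 Data.Nat.≤ n →
    Σ ℕ λ k → HasCard (InDilate V n) k × (ℕ→ℚ k ≡ evalPoly c (ℕ→ℚ n))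
  where import Data.Nat

SignPattern : {d : ℕ} → ℕ → Vec ℚ (suc d) → Set
SignPattern {d} r c =
  ∀ (i : Fin (suc d)) → (toℕ i ≡ r → lookup c i < 0ℚ) × (toℕ i ≢ r → 0ℚ < lookup c i)

ExistsPolytope : (e r : ℕ) → Set
ExistsPolytope e r =
  Σ ℕ λ N → Σ ℕ λ m → Σ (Fin m → Point N) λ V →
    HasDim V e × Σ (Vec ℚ (suc e)) λ c → IsEhrhartPoly V c × SignPattern r c

-- The prism P × [0, k] over an e-dimensional lattice polytope P is (e + 1)-dimensional,
-- and the lattice points of its n-th dilate are those of nP on each of the nk + 1 integer
-- levels, so its Ehrhart polynomial is (1 + k n) · i(P, n). The coefficient of n^j becomes
-- c_j + k c_(j-1), which for large k has the sign of c_(j-1) when j ≥ 1, and equals c_0 > 0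
-- when j = 0 (as r ≥ 1): the unique negative coefficient moves from n^r to n^(r+1).
module Submission where

open import Defs
open import Data.Nat as ℕ using (ℕ; zero; suc; s≤s; z≤n; _∸_)
import Data.Nat.Properties as ℕP
open import Data.Integer as ℤ using (ℤ; 0ℤ)
import Data.Integer.Properties as ℤP
open import Data.Rational as ℚ using (ℚ; 0ℚ; 1ℚ; _+_; _*_; _<_; _≤_; mkℚ; -_; _-_; 1/_)
import Data.Rational.Properties as ℚP
open import Data.Rational.Solver using (module +-*-Solver)
open +-*-Solver using (solve; _:+_; _:*_; _:-_; :-_; con; _:=_)
import Data.Nat.Coprimality as Coprimality
open import Data.Fin as Fin using (Fin; zero; suc; toℕ; punchIn; _↑ˡ_; _↑ʳ_; splitAt)
open import Data.Empty using (⊥; ⊥-elim)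
open import Data.Product as Prod using (∃; _×_; _,_; proj₁; proj₂)
open import Relation.Nullary using (¬_; Dec; yes; no)
open import Relation.Binary.PropositionalEquality
open import Data.Vec as Vec using (Vec; []; _∷_; lookup)
import Data.Vec.Properties as VecP
open import Data.List using (List; []; _∷_; length; map; upTo; cartesianProductWith)
import Data.List.Properties as ListP
open import Data.List.Membership.Propositional using (_∈_)
open import Data.List.Membership.Propositional.Properties
  using (∈-map⁺; ∈-map⁻; ∈-upTo⁺; ∈-upTo⁻; ∈-cartesianProductWith⁺; ∈-cartesianProductWith⁻)
open import Data.List.Relation.Unary.Unique.Propositional using (Unique)
import Data.List.Relation.Unary.Unique.Propositional.Properties as UniqueP
open import Function.Bundles using (_⇔_; mk⇔; Equivalence)
open import Function.Properties.Equivalence using () renaming (trans to ⇔-trans)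
open import Data.Vec.Functional using (insertAt)
open import Data.Vec.Functional.Properties using (insertAt-lookup; insertAt-punchIn)
open import Function using (_∘_; id)
open import Data.Sum using (inj₁; inj₂; [_,_]′)
import Data.Fin.Properties as FinP

ℤ→ℚ≡mkℚ : ∀ z → ℤ→ℚ z ≡ mkℚ z 0 (Coprimality.sym (Coprimality.1-coprimeTo _))
ℤ→ℚ≡mkℚ z = ℚP.↥p/↧p≡p _

ℤ→ℚ-+ : ∀ a b → ℤ→ℚ (a ℤ.+ b) ≡ ℤ→ℚ a + ℤ→ℚ b
ℤ→ℚ-+ a b = trans
  (ℚP./-cong {p₁ = a ℤ.+ b} {q₁ = 1} {p₂ = a ℤ.* ℤ.+ 1 ℤ.+ b ℤ.* ℤ.+ 1} {q₂ = 1}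
    (sym (cong₂ ℤ._+_ (ℤP.*-identityʳ a) (ℤP.*-identityʳ b))) refl)
  (cong₂ _+_ (sym (ℤ→ℚ≡mkℚ a)) (sym (ℤ→ℚ≡mkℚ b)))

ℤ→ℚ-* : ∀ a b → ℤ→ℚ (a ℤ.* b) ≡ ℤ→ℚ a * ℤ→ℚ b
ℤ→ℚ-* a b = cong₂ _*_ (sym (ℤ→ℚ≡mkℚ a)) (sym (ℤ→ℚ≡mkℚ b))

ℤ→ℚ-mono-≤ : ∀ {a b} → a ℤ.≤ b → ℤ→ℚ a ≤ ℤ→ℚ b
ℤ→ℚ-mono-≤ {a} {b} a≤b rewrite ℤ→ℚ≡mkℚ a | ℤ→ℚ≡mkℚ b =
  ℚ.*≤* (subst₂ ℤ._≤_ (sym (ℤP.*-identityʳ a)) (sym (ℤP.*-identityʳ b)) a≤b)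

ℤ→ℚ-cancel-≤ : ∀ {a b} → ℤ→ℚ a ≤ ℤ→ℚ b → a ℤ.≤ b
ℤ→ℚ-cancel-≤ {a} {b} le rewrite ℤ→ℚ≡mkℚ a | ℤ→ℚ≡mkℚ b with le
... | ℚ.*≤* p = subst₂ ℤ._≤_ (ℤP.*-identityʳ a) (ℤP.*-identityʳ b) p

ℕ→ℚ-* : ∀ a b → ℕ→ℚ (a ℕ.* b) ≡ ℕ→ℚ a * ℕ→ℚ b
ℕ→ℚ-* a b = trans (cong ℤ→ℚ (ℤP.pos-* a b)) (ℤ→ℚ-* (ℤ.+ a) (ℤ.+ b))

ℕ→ℚ-suc : ∀ a → ℕ→ℚ (suc a) ≡ 1ℚ + ℕ→ℚ a
ℕ→ℚ-suc a = trans (cong ℤ→ℚ (ℤP.pos-+ 1 a)) (ℤ→ℚ-+ (ℤ.+ 1) (ℤ.+ a))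

ℕ→ℚ-mono-≤ : ∀ {a b} → a ℕ.≤ b → ℕ→ℚ a ≤ ℕ→ℚ b
ℕ→ℚ-mono-≤ p = ℤ→ℚ-mono-≤ (ℤ.+≤+ p)

ℕ→ℚ-nonNeg : ∀ a → 0ℚ ≤ ℕ→ℚ a
ℕ→ℚ-nonNeg a = ℕ→ℚ-mono-≤ {0} {a} z≤n

ℕ→ℚ-suc-pos : ∀ a → 0ℚ < ℕ→ℚ (suc a)
ℕ→ℚ-suc-pos a rewrite ℤ→ℚ≡mkℚ (ℤ.+ suc a) = ℚ.*<* (ℤ.+<+ (s≤s z≤n))

+-nonNeg : ∀ {a b} → 0ℚ ≤ a → 0ℚ ≤ b → 0ℚ ≤ a + b
+-nonNeg {a} {b} 0≤a 0≤b = subst (_≤ a + b) (ℚP.+-identityʳ 0ℚ) (ℚP.+-mono-≤ 0≤a 0≤b)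

*-nonNeg : ∀ {a b} → 0ℚ ≤ a → 0ℚ ≤ b → 0ℚ ≤ a * b
*-nonNeg {a} {b} 0≤a 0≤b = subst (_≤ a * b) (ℚP.*-zeroʳ a) (ℚP.*-monoˡ-≤-nonNeg a 0≤b)
  where instance _ = ℚ.nonNegative 0≤a

*-cancelˡ-≡0 : ∀ a b → a ≢ 0ℚ → a * b ≡ 0ℚ → b ≡ 0ℚ
*-cancelˡ-≡0 a b a≢0 ab≡0 = begin
    b                  ≡⟨ sym (ℚP.*-identityˡ b) ⟩
    1ℚ * b             ≡⟨ cong (_* b) (sym (ℚP.*-inverseˡ a)) ⟩
    (1/ a) * a * b     ≡⟨ ℚP.*-assoc (1/ a) a b ⟩
    (1/ a) * (a * b)   ≡⟨ cong ((1/ a) *_) ab≡0 ⟩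
    (1/ a) * 0ℚ        ≡⟨ ℚP.*-zeroʳ (1/ a) ⟩
    0ℚ                 ∎
  where open ≡-Reasoning
        instance _ = ℚ.≢-nonZero a≢0

Σℚ-cong : ∀ m {f g : Fin m → ℚ} → (∀ i → f i ≡ g i) → Σℚ m f ≡ Σℚ m g
Σℚ-cong zero    _   = refl
Σℚ-cong (suc m) f≗g = cong₂ _+_ (f≗g zero) (Σℚ-cong m (f≗g ∘ suc))

Σℚ-+ : ∀ m (f g : Fin m → ℚ) → Σℚ m (λ i → f i + g i) ≡ Σℚ m f + Σℚ m g
Σℚ-+ zero    f g = refl
Σℚ-+ (suc m) f g = trans (cong ((f zero + g zero) +_) (Σℚ-+ m (f ∘ suc) (g ∘ suc)))
  (solve 4 (λ a b c d → (a :+ b) :+ (c :+ d) := (a :+ c) :+ (b :+ d)) refl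
    (f zero) (g zero) (Σℚ m (f ∘ suc)) (Σℚ m (g ∘ suc)))

Σℚ-*ˡ : ∀ m a (f : Fin m → ℚ) → Σℚ m (λ i → a * f i) ≡ a * Σℚ m f
Σℚ-*ˡ zero    a f = sym (ℚP.*-zeroʳ a)
Σℚ-*ˡ (suc m) a f = trans (cong (a * f zero +_) (Σℚ-*ˡ m a (f ∘ suc)))
  (sym (ℚP.*-distribˡ-+ a (f zero) _))

Σℚ-lincomb : ∀ m α β (f g : Fin m → ℚ) →
  Σℚ m (λ i → α * f i - β * g i) ≡ α * Σℚ m f - β * Σℚ m g
Σℚ-lincomb zero    α β f g = solve 2 (λ a b → con 0ℚ := a :* con 0ℚ :- b :* con 0ℚ) refl α β
Σℚ-lincomb (suc m) α β f g = trans (cong (α * f zero - β * g zero +_) (Σℚ-lincomb m α β (f ∘ suc) (g ∘ suc)))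
  (solve 6 (λ a b x y u v → (a :* x :- b :* y) :+ (a :* u :- b :* v) := a :* (x :+ u) :- b :* (y :+ v)) refl
    α β (f zero) (g zero) (Σℚ m (f ∘ suc)) (Σℚ m (g ∘ suc)))

Σℚ-lincomb-* : ∀ m α β (f g w : Fin m → ℚ) →
  Σℚ m (λ i → (α * f i - β * g i) * w i) ≡ α * Σℚ m (λ i → f i * w i) - β * Σℚ m (λ i → g i * w i)
Σℚ-lincomb-* m α β f g w = trans
  (Σℚ-cong m (λ i → solve 5 (λ a b x y z → (a :* x :- b :* y) :* z := a :* (x :* z) :- b :* (y :* z)) refl
    α β (f i) (g i) (w i)))
  (Σℚ-lincomb m α β (λ i → f i * w i) (λ i → g i * w i))

Σℚ-zero : ∀ m → Σℚ m (λ _ → 0ℚ) ≡ 0ℚ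
Σℚ-zero zero    = refl
Σℚ-zero (suc m) = cong (0ℚ +_) (Σℚ-zero m)

Σℚ-nonNeg : ∀ m (f : Fin m → ℚ) → (∀ i → 0ℚ ≤ f i) → 0ℚ ≤ Σℚ m f
Σℚ-nonNeg zero    f 0≤f = ℚP.≤-refl
Σℚ-nonNeg (suc m) f 0≤f = +-nonNeg (0≤f zero) (Σℚ-nonNeg m (f ∘ suc) (0≤f ∘ suc))

Σℚ-punchIn : ∀ {n} (j : Fin (suc n)) (f : Fin (suc n) → ℚ) → Σℚ (suc n) f ≡ f j + Σℚ n (f ∘ punchIn j)
Σℚ-punchIn               zero    f = refl
Σℚ-punchIn {n = suc n}   (suc j) f = trans (cong (f zero +_) (Σℚ-punchIn j (f ∘ suc)))
  (solve 3 (λ a b c → a :+ (b :+ c) := b :+ (a :+ c)) refl (f zero) (f (suc j)) (Σℚ n (f ∘ suc ∘ punchIn j)))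

Σℚ-↑ : ∀ m m' (f : Fin (m ℕ.+ m') → ℚ) → Σℚ (m ℕ.+ m') f ≡ Σℚ m (f ∘ (_↑ˡ m')) + Σℚ m' (f ∘ (m ↑ʳ_))
Σℚ-↑ zero    m' f = sym (ℚP.+-identityˡ _)
Σℚ-↑ (suc m) m' f = trans (cong (f zero +_) (Σℚ-↑ m m' (f ∘ suc))) (sym (ℚP.+-assoc (f zero) _ _))

Σℚ-insertAt-* : ∀ {n} (μ : Fin n → ℚ) j (w : Fin (suc n) → ℚ) →
  Σℚ (suc n) (λ x → insertAt μ j 0ℚ x * w x) ≡ Σℚ n (λ i → μ i * w (punchIn j i))
Σℚ-insertAt-* {n} μ j w = begin
  Σℚ (suc n) (λ x → μ̂ x * w x)                          ≡⟨ Σℚ-punchIn j (λ x → μ̂ x * w x) ⟩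
  μ̂ j * w j + Σℚ n (λ i → μ̂ (punchIn j i) * w (punchIn j i))
    ≡⟨ cong₂ _+_ (trans (cong (_* w j) (insertAt-lookup μ j 0ℚ)) (ℚP.*-zeroˡ (w j)))
                 (Σℚ-cong n (λ i → cong (_* w (punchIn j i)) (insertAt-punchIn μ j 0ℚ i))) ⟩
  0ℚ + Σℚ n (λ i → μ i * w (punchIn j i))              ≡⟨ ℚP.+-identityˡ _ ⟩
  Σℚ n (λ i → μ i * w (punchIn j i))                    ∎
  where open ≡-Reasoning
        μ̂ : Fin (suc n) → ℚ
        μ̂ = insertAt μ j 0ℚ

Σℚ-insertAt : ∀ {n} (μ : Fin n → ℚ) j → Σℚ (suc n) (insertAt μ j 0ℚ) ≡ Σℚ n μ
Σℚ-insertAt {n} μ j = begin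
  Σℚ (suc n) (insertAt μ j 0ℚ)              ≡⟨ Σℚ-cong (suc n) (λ x → sym (ℚP.*-identityʳ (insertAt μ j 0ℚ x))) ⟩
  Σℚ (suc n) (λ x → insertAt μ j 0ℚ x * 1ℚ) ≡⟨ Σℚ-insertAt-* μ j (λ _ → 1ℚ) ⟩
  Σℚ n (λ i → μ i * 1ℚ)                     ≡⟨ Σℚ-cong n (λ i → ℚP.*-identityʳ (μ i)) ⟩
  Σℚ n μ                                    ∎
  where open ≡-Reasoning

-- Affine independence

AffineRelation : ∀ {N m} → (Fin m → Point N) → (Fin m → ℚ) → Set
AffineRelation {N} {m} w μ =
  Σℚ m μ ≡ 0ℚ × (∀ (j : Fin N) → Σℚ m (λ i → μ i * ℤ→ℚ (lookup (w i) j)) ≡ 0ℚ)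

affineRelation-lincomb : ∀ {N m} {w : Fin m → Point N} {μ ν} α β →
  AffineRelation w μ → AffineRelation w ν → AffineRelation w (λ i → α * μ i - β * ν i)
affineRelation-lincomb {m = m} {μ = μ} {ν} α β (sμ , cμ) (sν , cν) =
  trans (Σℚ-lincomb m α β μ ν) (trans (cong₂ (λ u v → α * u - β * v) sμ sν) 0-0) ,
  λ j → trans (Σℚ-lincomb-* m α β μ ν _) (trans (cong₂ (λ u v → α * u - β * v) (cμ j) (cν j)) 0-0)
  where
  0-0 : α * 0ℚ - β * 0ℚ ≡ 0ℚ
  0-0 = solve 2 (λ a b → a :* con 0ℚ :- b :* con 0ℚ := con 0ℚ) refl α β

affineRelation-insertAt : ∀ {N n} (w : Fin (suc n) → Point N) μ j →
  AffineRelation (w ∘ punchIn j) μ → AffineRelation w (insertAt μ j 0ℚ)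
affineRelation-insertAt w μ j (s , cs) =
  trans (Σℚ-insertAt μ j) s , λ c → trans (Σℚ-insertAt-* μ j (λ x → ℤ→ℚ (lookup (w x) c))) (cs c)

AffIndep-cong : ∀ {N k} {w w' : Fin (suc k) → Point N} → (∀ i → w i ≡ w' i) → AffIndep w → AffIndep w'
AffIndep-cong {k = k} w≗w' indep μ s cs =
  indep μ s (λ j → trans (Σℚ-cong (suc k) (λ x → cong (λ p → μ x * ℤ→ℚ (lookup p j)) (w≗w' x))) (cs j))

pyramid : ∀ {N k} → ℤ → (Fin (suc k) → Point N) → Fin (suc (suc k)) → Point (suc N)
pyramid h Q zero    = h ∷ Q zero
pyramid h Q (suc i) = 0ℤ ∷ Q i

pyramid-affIndep : ∀ {N k} h (Q : Fin (suc k) → Point N) → ℤ→ℚ h ≢ 0ℚ →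
  AffIndep Q → AffIndep (pyramid h Q)
pyramid-affIndep {k = k} h Q h≢0 indep μ s cs = vanish
  where
  baseHeights≡0 : Σℚ (suc k) (λ i → μ (suc i) * ℤ→ℚ 0ℤ) ≡ 0ℚ
  baseHeights≡0 = trans (Σℚ-cong (suc k) (λ i → ℚP.*-zeroʳ (μ (suc i)))) (Σℚ-zero (suc k))
  μ₀≡0 : μ zero ≡ 0ℚ
  μ₀≡0 = *-cancelˡ-≡0 (ℤ→ℚ h) (μ zero) h≢0 (begin
    ℤ→ℚ h * μ zero                                             ≡⟨ ℚP.*-comm (ℤ→ℚ h) (μ zero) ⟩
    μ zero * ℤ→ℚ h                                             ≡⟨ sym (ℚP.+-identityʳ _) ⟩
    μ zero * ℤ→ℚ h + 0ℚ                                        ≡⟨ cong (μ zero * ℤ→ℚ h +_) (sym baseHeights≡0) ⟩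
    μ zero * ℤ→ℚ h + Σℚ (suc k) (λ i → μ (suc i) * ℤ→ℚ 0ℤ)   ≡⟨ cs zero ⟩
    0ℚ                                                          ∎)
    where open ≡-Reasoning
  dropApex : ∀ {a} b → a ≡ 0ℚ → a + b ≡ b
  dropApex b refl = ℚP.+-identityˡ b
  baseRelation : AffineRelation Q (μ ∘ suc)
  baseRelation = trans (sym (dropApex _ μ₀≡0)) s ,
    λ c → trans (sym (dropApex _ (trans (cong (_* ℤ→ℚ (lookup (Q zero) c)) μ₀≡0) (ℚP.*-zeroˡ (ℤ→ℚ (lookup (Q zero) c)))))) (cs (suc c))
  vanish : ∀ i → μ i ≡ 0ℚ
  vanish zero    = μ₀≡0
  vanish (suc i) = indep (μ ∘ suc) (proj₁ baseRelation) (proj₂ baseRelation) i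

-- Forgetting one coordinate lowers the dimension of an affine span by at most one.
affIndep-∷⇒¬∀-punchIn-dependent : ∀ {N k} (h : Fin (suc (suc k)) → ℤ) (P : Fin (suc (suc k)) → Point N) →
  AffIndep (λ x → h x ∷ P x) → ¬ (∀ j → ¬ AffIndep (P ∘ punchIn j))
affIndep-∷⇒¬∀-punchIn-dependent {k = k} h P indep allDependent = allDependent zero indep₀
  where
  heightSum : (Fin (suc (suc k)) → ℚ) → ℚ
  heightSum μ = Σℚ (suc (suc k)) (λ x → μ x * ℤ→ℚ (h x))

  vanish : ∀ μ → AffineRelation P μ → heightSum μ ≡ 0ℚ → ∀ x → μ x ≡ 0ℚ
  vanish μ (s , cs) hs = indep μ s λ { zero → hs ; (suc c) → cs c }

  indep₀ : AffIndep (P ∘ punchIn zero)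
  indep₀ μ₀ s₀ cs₀ a = vanish₀ (μ₀ a ℚP.≟ 0ℚ)
    where
    ρ₀ : Fin (suc (suc k)) → ℚ
    ρ₀ = insertAt μ₀ zero 0ℚ
    rel₀ : AffineRelation P ρ₀
    rel₀ = affineRelation-insertAt P μ₀ zero (s₀ , cs₀)

    -- A relation of the points other than suc a is either a relation of the lifts, or
    -- can be cancelled against ρ₀ to one; that one vanishes, which forces μ₀ a ≡ 0ℚ.
    indepₐ : μ₀ a ≢ 0ℚ → AffIndep (P ∘ punchIn (suc a))
    indepₐ μ₀a≢0 μ s cs b = vanishₐ (α ℚP.≟ 0ℚ)
      where
      ρ : Fin (suc (suc k)) → ℚ
      ρ = insertAt μ (suc a) 0ℚ
      rel : AffineRelation P ρ
      rel = affineRelation-insertAt P μ (suc a) (s , cs)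
      α β : ℚ
      α = heightSum ρ
      β = heightSum ρ₀
      ν : Fin (suc (suc k)) → ℚ
      ν x = α * ρ₀ x - β * ρ x
      ν-rel : AffineRelation P ν
      ν-rel = affineRelation-lincomb {w = P} {μ = ρ₀} {ν = ρ} α β rel₀ rel
      ν-heightSum : heightSum ν ≡ 0ℚ
      ν-heightSum = trans (Σℚ-lincomb-* (suc (suc k)) α β ρ₀ ρ (λ x → ℤ→ℚ (h x)))
        (solve 2 (λ a b → a :* b :- b :* a := con 0ℚ) refl α β)
      αμ₀a≡0 : α * μ₀ a ≡ 0ℚ
      αμ₀a≡0 = begin
        α * μ₀ a                  ≡⟨ solve 3 (λ a b m → a :* m := a :* m :- b :* con 0ℚ) refl α β (μ₀ a) ⟩
        α * μ₀ a - β * 0ℚ         ≡⟨ cong (λ z → α * μ₀ a - β * z) (sym (insertAt-lookup μ (suc a) 0ℚ)) ⟩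
        ν (suc a)                 ≡⟨ vanish ν ν-rel ν-heightSum (suc a) ⟩
        0ℚ                        ∎
        where open ≡-Reasoning
      vanishₐ : Dec (α ≡ 0ℚ) → μ b ≡ 0ℚ
      vanishₐ (yes α≡0) = trans (sym (insertAt-punchIn μ (suc a) 0ℚ b)) (vanish ρ rel α≡0 (punchIn (suc a) b))
      vanishₐ (no  α≢0) = ⊥-elim (μ₀a≢0 (*-cancelˡ-≡0 α (μ₀ a) α≢0 αμ₀a≡0))

    vanish₀ : Dec (μ₀ a ≡ 0ℚ) → μ₀ a ≡ 0ℚ
    vanish₀ (yes μ₀a≡0) = μ₀a≡0
    vanish₀ (no  μ₀a≢0) = ⊥-elim (allDependent (suc a) (indepₐ μ₀a≢0))

-- The prism P × [0, k]

prismHeight : ∀ {m} → ℕ → Fin (m ℕ.+ m) → ℤ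
prismHeight {m} k = [ (λ _ → 0ℤ) , (λ _ → ℤ.+ k) ]′ ∘ splitAt m

prismBase : ∀ {m} → Fin (m ℕ.+ m) → Fin m
prismBase {m} = [ id , id ]′ ∘ splitAt m

prism : ∀ {N m} → ℕ → (Fin m → Point N) → Fin (m ℕ.+ m) → Point (suc N)
prism {m = m} k V p = prismHeight {m} k p ∷ V (prismBase {m} p)

prism-↑ˡ : ∀ {N m} k (V : Fin m → Point N) i → prism k V (i ↑ˡ m) ≡ 0ℤ ∷ V i
prism-↑ˡ {m = m} k V i = cong (λ s → [ (λ _ → 0ℤ) , (λ _ → ℤ.+ k) ]′ s ∷ V ([ id , id ]′ s)) (FinP.splitAt-↑ˡ m i m)

prism-↑ʳ : ∀ {N m} k (V : Fin m → Point N) i → prism k V (m ↑ʳ i) ≡ ℤ.+ k ∷ V i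
prism-↑ʳ {m = m} k V i = cong (λ s → [ (λ _ → 0ℤ) , (λ _ → ℤ.+ k) ]′ s ∷ V ([ id , id ]′ s)) (FinP.splitAt-↑ʳ m m i)

prism-dim : ∀ {N m e} k (V : Fin m → Point N) → HasDim V e → HasDim (prism (suc k) V) (suc e)
prism-dim {m = m} {e} k V ((ι , indep) , noLarger) = (ι' , indep') , noLarger'
  where
  ι' : Fin (suc (suc e)) → Fin (m ℕ.+ m)
  ι' zero    = m ↑ʳ ι zero
  ι' (suc i) = ι i ↑ˡ m
  pyramid≡prism : ∀ x → pyramid (ℤ.+ suc k) (V ∘ ι) x ≡ prism (suc k) V (ι' x)
  pyramid≡prism zero    = sym (prism-↑ʳ (suc k) V (ι zero))
  pyramid≡prism (suc i) = sym (prism-↑ˡ (suc k) V (ι i))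
  indep' : AffIndep (prism (suc k) V ∘ ι')
  indep' = AffIndep-cong pyramid≡prism
    (pyramid-affIndep (ℤ.+ suc k) (V ∘ ι) (≢-sym (ℚP.<⇒≢ (ℕ→ℚ-suc-pos k))) indep)
  noLarger' : ∀ (κ : Fin (suc (suc (suc e))) → Fin (m ℕ.+ m)) → AffIndep (prism (suc k) V ∘ κ) → ⊥
  noLarger' κ indepκ = affIndep-∷⇒¬∀-punchIn-dependent (prismHeight {m} (suc k) ∘ κ) (V ∘ prismBase {m} ∘ κ)
    indepκ (λ j → noLarger (prismBase {m} ∘ κ ∘ punchIn j))

prism-Σ : ∀ {N m} k (V : Fin m → Point N) (λ' : Fin (m ℕ.+ m) → ℚ) c →
  Σℚ (m ℕ.+ m) (λ p → λ' p * ℤ→ℚ (lookup (prism k V p) c)) ≡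
  Σℚ m (λ i → λ' (i ↑ˡ m) * ℤ→ℚ (lookup (0ℤ ∷ V i) c)) + Σℚ m (λ i → λ' (m ↑ʳ i) * ℤ→ℚ (lookup (ℤ.+ k ∷ V i) c))
prism-Σ {m = m} k V λ' c = trans (Σℚ-↑ m m (λ p → λ' p * ℤ→ℚ (lookup (prism k V p) c)))
  (cong₂ _+_ (Σℚ-cong m (λ i → cong (λ v → λ' (i ↑ˡ m) * ℤ→ℚ (lookup v c)) (prism-↑ˡ k V i)))
             (Σℚ-cong m (λ i → cong (λ v → λ' (m ↑ʳ i) * ℤ→ℚ (lookup v c)) (prism-↑ʳ k V i))))

prism-height : ∀ {N m} k (V : Fin m → Point N) (λ' : Fin (m ℕ.+ m) → ℚ) →
  Σℚ (m ℕ.+ m) (λ p → λ' p * ℤ→ℚ (lookup (prism k V p) zero)) ≡ ℕ→ℚ k * Σℚ m (λ i → λ' (m ↑ʳ i))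
prism-height {m = m} k V λ' = begin
  Σℚ (m ℕ.+ m) (λ p → λ' p * ℤ→ℚ (lookup (prism k V p) zero))        ≡⟨ prism-Σ k V λ' zero ⟩
  Σℚ m (λ i → λ' (i ↑ˡ m) * 0ℚ) + Σℚ m (λ i → λ' (m ↑ʳ i) * ℕ→ℚ k)
    ≡⟨ cong₂ _+_ (trans (Σℚ-cong m (λ i → ℚP.*-zeroʳ (λ' (i ↑ˡ m)))) (Σℚ-zero m))
                 (Σℚ-cong m (λ i → ℚP.*-comm (λ' (m ↑ʳ i)) (ℕ→ℚ k))) ⟩
  0ℚ + Σℚ m (λ i → ℕ→ℚ k * λ' (m ↑ʳ i))                                ≡⟨ ℚP.+-identityˡ _ ⟩
  Σℚ m (λ i → ℕ→ℚ k * λ' (m ↑ʳ i))                                      ≡⟨ Σℚ-*ˡ m (ℕ→ℚ k) (λ i → λ' (m ↑ʳ i)) ⟩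
  ℕ→ℚ k * Σℚ m (λ i → λ' (m ↑ʳ i))                                      ∎
  where open ≡-Reasoning

prism-base : ∀ {N m} k (V : Fin m → Point N) (λ' : Fin (m ℕ.+ m) → ℚ) j →
  Σℚ (m ℕ.+ m) (λ p → λ' p * ℤ→ℚ (lookup (prism k V p) (suc j))) ≡
  Σℚ m (λ i → (λ' (i ↑ˡ m) + λ' (m ↑ʳ i)) * ℤ→ℚ (lookup (V i) j))
prism-base {m = m} k V λ' j = trans (prism-Σ k V λ' (suc j))
  (trans (sym (Σℚ-+ m (λ i → λ' (i ↑ˡ m) * v i) (λ i → λ' (m ↑ʳ i) * v i)))
         (Σℚ-cong m (λ i → sym (ℚP.*-distribʳ-+ (v i) (λ' (i ↑ˡ m)) (λ' (m ↑ʳ i))))))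
  where v = λ i → ℤ→ℚ (lookup (V i) j)

prism-InDilate⁻ : ∀ {N m} k (V : Fin m → Point N) n t x →
  InDilate (prism k V) n (t ∷ x) → (0ℤ ℤ.≤ t × t ℤ.≤ ℤ.+ (n ℕ.* k)) × InDilate V n x
prism-InDilate⁻ {m = m} k V n t x (y' , (λ' , (λ'≥0 , Σλ'≡1) , hull) , dil) =
  (ℤ→ℚ-cancel-≤ t≥0 , ℤ→ℚ-cancel-≤ t≤nk) ,
  (y' ∘ suc , (w , (w≥0 , Σw≡1) , λ j → trans (hull (suc j)) (prism-base k V λ' j)) , dil ∘ suc)
  where
  bottom top w : Fin m → ℚ
  bottom i = λ' (i ↑ˡ m)
  top    i = λ' (m ↑ʳ i)
  w      i = bottom i + top i
  σ : ℚ
  σ = Σℚ m top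
  Σλ'≡bottom+top : Σℚ m bottom + σ ≡ 1ℚ
  Σλ'≡bottom+top = trans (sym (Σℚ-↑ m m λ')) Σλ'≡1
  w≥0 : ∀ i → 0ℚ ≤ w i
  w≥0 i = +-nonNeg (λ'≥0 _) (λ'≥0 _)
  Σw≡1 : Σℚ m w ≡ 1ℚ
  Σw≡1 = trans (Σℚ-+ m bottom top) Σλ'≡bottom+top
  σ≥0 : 0ℚ ≤ σ
  σ≥0 = Σℚ-nonNeg m top (λ'≥0 ∘ (m ↑ʳ_))
  σ≤1 : σ ≤ 1ℚ
  σ≤1 = subst₂ _≤_ (ℚP.+-identityˡ σ) Σλ'≡bottom+top
          (ℚP.+-monoˡ-≤ σ (Σℚ-nonNeg m bottom (λ'≥0 ∘ (_↑ˡ m))))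
  t≡nkσ : ℤ→ℚ t ≡ ℕ→ℚ n * (ℕ→ℚ k * σ)
  t≡nkσ = trans (dil zero) (cong (ℕ→ℚ n *_) (trans (hull zero) (prism-height k V λ')))
  t≥0 : 0ℚ ≤ ℤ→ℚ t
  t≥0 = subst (0ℚ ≤_) (sym t≡nkσ) (*-nonNeg (ℕ→ℚ-nonNeg n) (*-nonNeg (ℕ→ℚ-nonNeg k) σ≥0))
  t≤nk : ℤ→ℚ t ≤ ℕ→ℚ (n ℕ.* k)
  t≤nk = subst₂ _≤_ (sym t≡nkσ) (trans (cong (ℕ→ℚ n *_) (ℚP.*-identityʳ (ℕ→ℚ k))) (sym (ℕ→ℚ-* n k)))
           (ℚP.*-monoˡ-≤-nonNeg (ℕ→ℚ n) (ℚP.*-monoˡ-≤-nonNeg (ℕ→ℚ k) σ≤1))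
    where instance
      _ = ℚ.nonNegative (ℕ→ℚ-nonNeg n)
      _ = ℚ.nonNegative (ℕ→ℚ-nonNeg k)

-- Splitting w in the ratio (1 − s) : s between the bottom and the top vertices of a prism
-- of height k lifts the point that w describes to height s k.
stackWeights : ∀ {m} → ℚ → (Fin m → ℚ) → Fin (m ℕ.+ m) → ℚ
stackWeights {m} s w = [ (λ i → (1ℚ - s) * w i) , (λ i → s * w i) ]′ ∘ splitAt m

stackWeights-↑ˡ : ∀ {m} s (w : Fin m → ℚ) i → stackWeights s w (i ↑ˡ m) ≡ (1ℚ - s) * w i
stackWeights-↑ˡ {m} s w i = cong [ (λ i → (1ℚ - s) * w i) , (λ i → s * w i) ]′ (FinP.splitAt-↑ˡ m i m)

stackWeights-↑ʳ : ∀ {m} s (w : Fin m → ℚ) i → stackWeights s w (m ↑ʳ i) ≡ s * w i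
stackWeights-↑ʳ {m} s w i = cong [ (λ i → (1ℚ - s) * w i) , (λ i → s * w i) ]′ (FinP.splitAt-↑ʳ m m i)

stackWeights-convex : ∀ {m s} {w : Fin m → ℚ} → 0ℚ ≤ s → s ≤ 1ℚ → Convex m w → Convex (m ℕ.+ m) (stackWeights s w)
stackWeights-convex {m} {s} {w} s≥0 s≤1 (w≥0 , Σw≡1) = nonNeg , sum≡1
  where
  1-s≥0 : 0ℚ ≤ 1ℚ - s
  1-s≥0 = subst (_≤ 1ℚ - s) (ℚP.+-inverseʳ s) (ℚP.+-monoˡ-≤ (- s) s≤1)
  nonNeg : ∀ p → 0ℚ ≤ stackWeights s w p
  nonNeg p with splitAt m p
  ... | inj₁ i = *-nonNeg 1-s≥0 (w≥0 i)
  ... | inj₂ i = *-nonNeg s≥0 (w≥0 i)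
  sum≡1 : Σℚ (m ℕ.+ m) (stackWeights s w) ≡ 1ℚ
  sum≡1 = begin
    Σℚ (m ℕ.+ m) (stackWeights s w)
      ≡⟨ Σℚ-↑ m m (stackWeights s w) ⟩
    Σℚ m (stackWeights s w ∘ (_↑ˡ m)) + Σℚ m (stackWeights s w ∘ (m ↑ʳ_))
      ≡⟨ cong₂ _+_ (Σℚ-cong m (stackWeights-↑ˡ s w)) (Σℚ-cong m (stackWeights-↑ʳ s w)) ⟩
    Σℚ m (λ i → (1ℚ - s) * w i) + Σℚ m (λ i → s * w i)
      ≡⟨ cong₂ _+_ (Σℚ-*ˡ m (1ℚ - s) w) (Σℚ-*ˡ m s w) ⟩
    (1ℚ - s) * Σℚ m w + s * Σℚ m w
      ≡⟨ cong (λ z → (1ℚ - s) * z + s * z) Σw≡1 ⟩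
    (1ℚ - s) * 1ℚ + s * 1ℚ
      ≡⟨ solve 1 (λ s → (con 1ℚ :- s) :* con 1ℚ :+ s :* con 1ℚ := con 1ℚ) refl s ⟩
    1ℚ ∎
    where open ≡-Reasoning

prism-InDilate⁺ : ∀ {N m} k (V : Fin m → Point N) n t x →
  (0ℤ ℤ.≤ t × t ℤ.≤ ℤ.+ (suc n ℕ.* suc k)) → InDilate V (suc n) x → InDilate (prism (suc k) V) (suc n) (t ∷ x)
prism-InDilate⁺ k V n ℤ.-[1+ _ ] x (() , _)
prism-InDilate⁺ {m = m} k V n (ℤ.+ t) x (_ , ℤ.+≤+ t≤nk) (y , (w , w-convex@(_ , Σw≡1) , hull) , dil) =
  y' , (λ' , stackWeights-convex s≥0 s≤1 w-convex , (λ c → refl)) , dil'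
  where
  D : ℚ
  D = ℕ→ℚ (suc n ℕ.* suc k)
  instance
    _ = ℚ.positive (ℕ→ℚ-suc-pos (k ℕ.+ n ℕ.* suc k))
    _ = ℚP.pos⇒nonZero D
  1/D≥0 : 0ℚ ≤ 1/ D
  1/D≥0 = ℚP.<⇒≤ (ℚP.positive⁻¹ (1/ D) {{ℚP.1/pos⇒pos D}})
  -- the point t ∷ x sits at the fraction s of the height n k of the dilated prism
  s : ℚ
  s = ℕ→ℚ t * 1/ D
  s≥0 : 0ℚ ≤ s
  s≥0 = *-nonNeg (ℕ→ℚ-nonNeg t) 1/D≥0
  s≤1 : s ≤ 1ℚ
  s≤1 = subst (s ≤_) (ℚP.*-inverseʳ D) (ℚP.*-monoʳ-≤-nonNeg (1/ D) {{ℚ.nonNegative 1/D≥0}} (ℕ→ℚ-mono-≤ t≤nk))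
  λ' : Fin (m ℕ.+ m) → ℚ
  λ' = stackWeights s w
  y' : Fin (suc _) → ℚ
  y' c = Σℚ (m ℕ.+ m) (λ p → λ' p * ℤ→ℚ (lookup (prism (suc k) V p) c))
  y'-height : y' zero ≡ ℕ→ℚ (suc k) * s
  y'-height = begin
    y' zero                                   ≡⟨ prism-height (suc k) V λ' ⟩
    ℕ→ℚ (suc k) * Σℚ m (λ' ∘ (m ↑ʳ_))         ≡⟨ cong (ℕ→ℚ (suc k) *_) (trans (Σℚ-cong m (stackWeights-↑ʳ s w)) (Σℚ-*ˡ m s w)) ⟩
    ℕ→ℚ (suc k) * (s * Σℚ m w)                ≡⟨ cong (λ z → ℕ→ℚ (suc k) * (s * z)) Σw≡1 ⟩
    ℕ→ℚ (suc k) * (s * 1ℚ)                    ≡⟨ cong (ℕ→ℚ (suc k) *_) (ℚP.*-identityʳ s) ⟩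
    ℕ→ℚ (suc k) * s                           ∎
    where open ≡-Reasoning
  y'-base : ∀ j → y' (suc j) ≡ y j
  y'-base j = begin
    y' (suc j)                                                    ≡⟨ prism-base (suc k) V λ' j ⟩
    Σℚ m (λ i → (λ' (i ↑ˡ m) + λ' (m ↑ʳ i)) * v i)                ≡⟨ Σℚ-cong m (λ i → cong₂ (λ a b → (a + b) * v i) (stackWeights-↑ˡ s w i) (stackWeights-↑ʳ s w i)) ⟩
    Σℚ m (λ i → ((1ℚ - s) * w i + s * w i) * v i)
      ≡⟨ Σℚ-cong m (λ i → solve 3 (λ s w v → ((con 1ℚ :- s) :* w :+ s :* w) :* v := w :* v) refl s (w i) (v i)) ⟩
    Σℚ m (λ i → w i * v i)                                        ≡⟨ sym (hull j) ⟩
    y j                                                           ∎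
    where open ≡-Reasoning
          v : Fin m → ℚ
          v i = ℤ→ℚ (lookup (V i) j)
  dil' : ∀ c → ℤ→ℚ (lookup (ℤ.+ t ∷ x) c) ≡ ℕ→ℚ (suc n) * y' c
  dil' zero = sym (begin
    ℕ→ℚ (suc n) * y' zero                        ≡⟨ cong (ℕ→ℚ (suc n) *_) y'-height ⟩
    ℕ→ℚ (suc n) * (ℕ→ℚ (suc k) * (ℕ→ℚ t * 1/ D))
      ≡⟨ solve 4 (λ n k t d → n :* (k :* (t :* d)) := (n :* k :* d) :* t) refl (ℕ→ℚ (suc n)) (ℕ→ℚ (suc k)) (ℕ→ℚ t) (1/ D) ⟩
    (ℕ→ℚ (suc n) * ℕ→ℚ (suc k) * 1/ D) * ℕ→ℚ t  ≡⟨ cong (λ z → z * 1/ D * ℕ→ℚ t) (sym (ℕ→ℚ-* (suc n) (suc k))) ⟩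
    (D * 1/ D) * ℕ→ℚ t                          ≡⟨ cong (_* ℕ→ℚ t) (ℚP.*-inverseʳ D) ⟩
    1ℚ * ℕ→ℚ t                                  ≡⟨ ℚP.*-identityˡ (ℕ→ℚ t) ⟩
    ℕ→ℚ t                                       ∎)
    where open ≡-Reasoning
  dil' (suc j) = trans (dil j) (cong (ℕ→ℚ (suc n) *_) (sym (y'-base j)))

-- Counting lattice points

HasCard-resp-⇔ : ∀ {N} {S T : Point N → Set} {c} → (∀ x → S x ⇔ T x) → HasCard S c → HasCard T c
HasCard-resp-⇔ S⇔T (L , |L|≡c , uniqueL , L⇔S) =
  L , |L|≡c , uniqueL , λ x → ⇔-trans (L⇔S x) (S⇔T x)

length-cartesianProductWith : ∀ {A B C : Set} (f : A → B → C) xs ys →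
  length (cartesianProductWith f xs ys) ≡ length xs ℕ.* length ys
length-cartesianProductWith f []       ys = refl
length-cartesianProductWith f (x ∷ xs) ys =
  trans (ListP.length-++ (map (f x) ys))
        (cong₂ ℕ._+_ (ListP.length-map (f x) ys) (length-cartesianProductWith f xs ys))

HasCard-∷ : ∀ {N} {S : Point N → Set} {c} (H : List ℤ) → Unique H → HasCard S c →
  HasCard (λ y → Vec.head y ∈ H × S (Vec.tail y)) (length H ℕ.* c)
HasCard-∷ {S = S} H uniqueH (L , refl , uniqueL , L⇔S) =
  cartesianProductWith _∷_ H L ,
  length-cartesianProductWith _∷_ H L ,
  UniqueP.cartesianProductWith⁺ _∷_ VecP.∷-injective uniqueH uniqueL ,
  λ { (t ∷ x) → mk⇔ (to t x) (λ (t∈H , Sx) → ∈-cartesianProductWith⁺ _∷_ t∈H (Equivalence.from (L⇔S x) Sx)) }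
  where
  to : ∀ t x → t ∷ x ∈ cartesianProductWith _∷_ H L → t ∈ H × S x
  to t x tx∈ with ∈-cartesianProductWith⁻ _∷_ H L tx∈
  ... | _ , _ , t∈H , x∈L , refl = t∈H , Equivalence.to (L⇔S x) x∈L

integerInterval : ℕ → List ℤ
integerInterval a = map ℤ.+_ (upTo (suc a))

length-integerInterval : ∀ a → length (integerInterval a) ≡ suc a
length-integerInterval a = trans (ListP.length-map ℤ.+_ (upTo (suc a))) (ListP.length-upTo (suc a))

integerInterval-unique : ∀ a → Unique (integerInterval a)
integerInterval-unique a = UniqueP.map⁺ ℤP.+-injective (UniqueP.upTo⁺ (suc a))

∈-integerInterval : ∀ a t → t ∈ integerInterval a ⇔ (0ℤ ℤ.≤ t × t ℤ.≤ ℤ.+ a)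
∈-integerInterval a t = mk⇔ to from
  where
  to : t ∈ integerInterval a → 0ℤ ℤ.≤ t × t ℤ.≤ ℤ.+ a
  to t∈ with ∈-map⁻ ℤ.+_ t∈
  ... | i , i∈ , refl = ℤ.+≤+ z≤n , ℤ.+≤+ (ℕP.≤-pred (∈-upTo⁻ i∈))
  from : 0ℤ ℤ.≤ t × t ℤ.≤ ℤ.+ a → t ∈ integerInterval a
  from (ℤ.+≤+ _ , ℤ.+≤+ i≤a) = ∈-map⁺ ℤ.+_ (∈-upTo⁺ (s≤s i≤a))

evalPoly-[a] : ∀ a x → evalPoly (a ∷ []) x ≡ a
evalPoly-[a] a x = trans (ℚP.+-identityʳ (a * 1ℚ)) (ℚP.*-identityʳ a)

evalPoly-∷ : ∀ {d} a (c : Vec ℚ (suc d)) x → evalPoly (a ∷ c) x ≡ a + x * evalPoly c x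
evalPoly-∷ {d} a c x = cong₂ _+_ (ℚP.*-identityʳ a)
  (trans (Σℚ-cong (suc d) (λ i → solve 3 (λ c x p → c :* (x :* p) := x :* (c :* p)) refl
                                    (lookup c i) x (x ^ℚ toℕ i)))
         (Σℚ-*ˡ (suc d) x (λ i → lookup c i * (x ^ℚ toℕ i))))

-- The coefficients of K p + (1 + K x) · c(x).
mul1+KX-carry : ∀ {d} → ℚ → ℚ → Vec ℚ d → Vec ℚ (suc d)
mul1+KX-carry K p []      = K * p ∷ []
mul1+KX-carry K p (a ∷ c) = a + K * p ∷ mul1+KX-carry K a c

mul1+KX : ∀ {d} → ℚ → Vec ℚ d → Vec ℚ (suc d)
mul1+KX K = mul1+KX-carry K 0ℚ

evalPoly-mul1+KX-carry : ∀ {d} K p (c : Vec ℚ (suc d)) x →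
  evalPoly (mul1+KX-carry K p c) x ≡ K * p + (1ℚ + K * x) * evalPoly c x
evalPoly-mul1+KX-carry K p (a ∷ []) x = begin
  evalPoly ((a + K * p) ∷ K * a ∷ []) x       ≡⟨ evalPoly-∷ (a + K * p) (K * a ∷ []) x ⟩
  a + K * p + x * evalPoly (K * a ∷ []) x      ≡⟨ cong (λ z → a + K * p + x * z) (evalPoly-[a] (K * a) x) ⟩
  a + K * p + x * (K * a)                      ≡⟨ solve 4 (λ a k p x → a :+ k :* p :+ x :* (k :* a) := k :* p :+ (con 1ℚ :+ k :* x) :* a) refl a K p x ⟩
  K * p + (1ℚ + K * x) * a                     ≡⟨ cong (λ z → K * p + (1ℚ + K * x) * z) (sym (evalPoly-[a] a x)) ⟩
  K * p + (1ℚ + K * x) * evalPoly (a ∷ []) x   ∎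
  where open ≡-Reasoning
evalPoly-mul1+KX-carry K p (a ∷ c@(_ ∷ _)) x = begin
  evalPoly ((a + K * p) ∷ mul1+KX-carry K a c) x             ≡⟨ evalPoly-∷ (a + K * p) (mul1+KX-carry K a c) x ⟩
  a + K * p + x * evalPoly (mul1+KX-carry K a c) x           ≡⟨ cong (λ z → a + K * p + x * z) (evalPoly-mul1+KX-carry K a c x) ⟩
  a + K * p + x * (K * a + (1ℚ + K * x) * E)
    ≡⟨ solve 5 (λ a k p x e → a :+ k :* p :+ x :* (k :* a :+ (con 1ℚ :+ k :* x) :* e)
                             := k :* p :+ (con 1ℚ :+ k :* x) :* (a :+ x :* e)) refl a K p x E ⟩
  K * p + (1ℚ + K * x) * (a + x * E)                          ≡⟨ cong (λ z → K * p + (1ℚ + K * x) * z) (sym (evalPoly-∷ a c x)) ⟩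
  K * p + (1ℚ + K * x) * evalPoly (a ∷ c) x                   ∎
  where open ≡-Reasoning
        E : ℚ
        E = evalPoly c x

evalPoly-mul1+KX : ∀ {d} K (c : Vec ℚ (suc d)) x → evalPoly (mul1+KX K c) x ≡ (1ℚ + K * x) * evalPoly c x
evalPoly-mul1+KX K c x = trans (evalPoly-mul1+KX-carry K 0ℚ c x)
  (trans (cong (_+ (1ℚ + K * x) * evalPoly c x) (ℚP.*-zeroʳ K)) (ℚP.+-identityˡ _))

coeff : ∀ {d} → Vec ℚ d → ℕ → ℚ
coeff []      _       = 0ℚ
coeff (a ∷ c) zero    = a
coeff (a ∷ c) (suc i) = coeff c i

lookup≡coeff : ∀ {d} (c : Vec ℚ d) i → lookup c i ≡ coeff c (toℕ i)
lookup≡coeff (a ∷ c) zero    = refl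
lookup≡coeff (a ∷ c) (suc i) = lookup≡coeff c i

lookup-mul1+KX-carry : ∀ {d} K p (c : Vec ℚ d) i →
  lookup (mul1+KX-carry K p c) i ≡ coeff c (toℕ i) + K * coeff (p ∷ c) (toℕ i)
lookup-mul1+KX-carry K p []      zero    = sym (ℚP.+-identityˡ (K * p))
lookup-mul1+KX-carry K p (a ∷ c) zero    = refl
lookup-mul1+KX-carry K p (a ∷ c) (suc i) = lookup-mul1+KX-carry K a c i

-- Signs of the coefficients for large K

Eventually : (ℕ → Set) → Set
Eventually P = ∃ λ K₀ → ∀ K → K₀ ℕ.≤ K → P K

eventually-∀< : ∀ {P : ℕ → ℕ → Set} n → (∀ j → j ℕ.< n → Eventually (P j)) →
  Eventually (λ K → ∀ j → j ℕ.< n → P j K)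
eventually-∀< zero    _  = 0 , λ _ _ _ ()
eventually-∀< {P} (suc n) ev with eventually-∀< n (λ j j<n → ev j (ℕP.m<n⇒m<1+n j<n)) | ev n (ℕP.n<1+n n)
... | K₁ , below | K₂ , at = K₁ ℕ.⊔ K₂ , all
  where
  all : ∀ K → K₁ ℕ.⊔ K₂ ℕ.≤ K → ∀ j → j ℕ.< suc n → P j K
  all K K₁⊔K₂≤K j j<1+n with ℕP.m<1+n⇒m<n∨m≡n j<1+n
  ... | inj₁ j<n  = below K (ℕP.≤-trans (ℕP.m≤m⊔n K₁ K₂) K₁⊔K₂≤K) j j<n
  ... | inj₂ refl = at K (ℕP.≤-trans (ℕP.m≤n⊔m K₁ K₂) K₁⊔K₂≤K)

i≤+∣i∣ : ∀ i → i ℤ.≤ ℤ.+ ℤ.∣ i ∣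
i≤+∣i∣ (ℤ.+ n)    = ℤP.≤-refl
i≤+∣i∣ ℤ.-[1+ n ] = ℤ.-≤+

archimedean : ∀ q → ∃ λ k → q < ℕ→ℚ k
archimedean (mkℚ n d c) = suc ℤ.∣ n ∣ , subst (mkℚ n d c <_) (sym (ℤ→ℚ≡mkℚ (ℤ.+ suc ℤ.∣ n ∣))) (ℚ.*<* n<∣n∣+1)
  where
  n<∣n∣+1 : n ℤ.* ℤ.+ 1 ℤ.< ℤ.+ suc ℤ.∣ n ∣ ℤ.* ℤ.+ suc d
  n<∣n∣+1 = subst₂ ℤ._<_ (sym (ℤP.*-identityʳ n)) (ℤP.pos-* (suc ℤ.∣ n ∣) (suc d))
    (ℤP.≤-<-trans (i≤+∣i∣ n) (ℤ.+<+ (ℕP.<-≤-trans (ℕP.n<1+n ℤ.∣ n ∣) (ℕP.m≤m*n (suc ℤ.∣ n ∣) (suc d)))))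

eventually-<-* : ∀ {a} b → 0ℚ < a → Eventually (λ K → b < ℕ→ℚ K * a)
eventually-<-* {a} b a>0 =
  K₀ , λ K K₀≤K → subst (_< ℕ→ℚ K * a) b/a*a≡b (ℚP.*-monoˡ-<-pos a (ℚP.<-≤-trans b/a<K₀ (ℕ→ℚ-mono-≤ K₀≤K)))
  where
  instance
    _ = ℚ.positive a>0
    _ = ℚ.>-nonZero a>0
  K₀ : ℕ
  K₀ = proj₁ (archimedean (b * 1/ a))
  b/a<K₀ : b * 1/ a < ℕ→ℚ K₀
  b/a<K₀ = proj₂ (archimedean (b * 1/ a))
  b/a*a≡b : b * 1/ a * a ≡ b
  b/a*a≡b = trans (ℚP.*-assoc b (1/ a) a) (trans (cong (b *_) (ℚP.*-inverseˡ a)) (ℚP.*-identityʳ b))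

SignAt : ℕ → ℕ → ℚ → Set
SignAt r i q = (i ≡ r → q < 0ℚ) × (i ≢ r → 0ℚ < q)

signAt-shift : ∀ {r j a} b → SignAt r j a → Eventually (λ K → SignAt (suc r) (suc j) (b + ℕ→ℚ K * a))
signAt-shift {r} {j} {a} b (neg , pos) with j ℕ.≟ r
... | yes j≡r = Prod.map₂ (λ large K K₀≤K → (λ _ → sum<0 (ℕ→ℚ K) (large K K₀≤K)) , (λ 1+j≢1+r → ⊥-elim (1+j≢1+r (cong suc j≡r))))
                  (eventually-<-* b (ℚP.neg-antimono-< (neg j≡r)))
  where
  sum<0 : ∀ K → b < K * (- a) → b + K * a < 0ℚ
  sum<0 K b<-Ka = subst (b + K * a <_) (solve 2 (λ a k → k :* (:- a) :+ k :* a := con 0ℚ) refl a K)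
    (ℚP.+-monoˡ-< (K * a) b<-Ka)
... | no  j≢r = Prod.map₂ (λ large K K₀≤K → (λ 1+j≡1+r → ⊥-elim (j≢r (ℕP.suc-injective 1+j≡1+r))) , (λ _ → 0<sum (ℕ→ℚ K) (large K K₀≤K)))
                  (eventually-<-* (- b) (pos j≢r))
  where
  0<sum : ∀ K → - b < K * a → 0ℚ < b + K * a
  0<sum K -b<Ka = subst₂ _<_ (ℚP.+-inverseˡ b) (ℚP.+-comm (K * a) b) (ℚP.+-monoˡ-< b -b<Ka)

mul1+KX-signPattern : ∀ {e} r (c : Vec ℚ (suc e)) → 1 ℕ.≤ r → SignPattern r c →
  Eventually (λ K → SignPattern (suc r) (mul1+KX (ℕ→ℚ K) c))
mul1+KX-signPattern {e} r c 1≤r signs =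
  K₀ , λ K K₀≤K i → subst (SignAt (suc r) (toℕ i)) (sym (lookup-mul1+KX-carry (ℕ→ℚ K) 0ℚ c i)) (newSigns K K₀≤K i)
  where
  coeffSign : ∀ j → j ℕ.< suc e → SignAt r j (coeff c j)
  coeffSign j j<1+e = subst (λ j → SignAt r j (coeff c j)) (FinP.toℕ-fromℕ< j<1+e)
    (subst (SignAt r _) (lookup≡coeff c (Fin.fromℕ< j<1+e)) (signs (Fin.fromℕ< j<1+e)))
  shifted : Eventually (λ K → ∀ j → j ℕ.< suc e → SignAt (suc r) (suc j) (coeff c (suc j) + ℕ→ℚ K * coeff c j))
  shifted = eventually-∀< (suc e) (λ j j<1+e → signAt-shift (coeff c (suc j)) (coeffSign j j<1+e))
  K₀ : ℕ
  K₀ = proj₁ shifted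
  newSigns : ∀ K → K₀ ℕ.≤ K → ∀ i → SignAt (suc r) (toℕ i) (coeff c (toℕ i) + ℕ→ℚ K * coeff (0ℚ ∷ c) (toℕ i))
  newSigns K _     zero    = (λ ()) , λ _ →
    subst (0ℚ <_) (sym (trans (cong (coeff c 0 +_) (ℚP.*-zeroʳ (ℕ→ℚ K))) (ℚP.+-identityʳ (coeff c 0))))
      (proj₂ (coeffSign 0 (s≤s z≤n)) (λ 0≡r → ℕP.<-irrefl 0≡r 1≤r))
  newSigns K K₀≤K (suc i) = proj₂ shifted K K₀≤K (toℕ i) (FinP.toℕ<n i)

prism-HasCard : ∀ {N m} k (V : Fin m → Point N) n {c} → HasCard (InDilate V (suc n)) c →
  HasCard (InDilate (prism (suc k) V) (suc n)) (suc (suc n ℕ.* suc k) ℕ.* c)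
prism-HasCard k V n {c} card = HasCard-resp-⇔ layers⇔prism
  (subst (HasCard _) (cong (ℕ._* c) (length-integerInterval a))
    (HasCard-∷ (integerInterval a) (integerInterval-unique a) card))
  where
  a = suc n ℕ.* suc k
  layers⇔prism : ∀ y → (Vec.head y ∈ integerInterval a × InDilate V (suc n) (Vec.tail y)) ⇔
                        InDilate (prism (suc k) V) (suc n) y
  layers⇔prism (t ∷ x) = mk⇔
    (λ (t∈ , x∈) → prism-InDilate⁺ k V n t x (Equivalence.to (∈-integerInterval a t) t∈) x∈)
    (λ tx∈ → Prod.map₁ (Equivalence.from (∈-integerInterval a t)) (prism-InDilate⁻ (suc k) V (suc n) t x tx∈))

prism-ehrhart : ∀ {N m d} k (V : Fin m → Point N) (c : Vec ℚ (suc d)) → IsEhrhartPoly V c →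
  IsEhrhartPoly (prism (suc k) V) (mul1+KX (ℕ→ℚ (suc k)) c)
prism-ehrhart k V c ehrhart (suc n) _ with ehrhart (suc n) (s≤s z≤n)
... | count , card , count≡c[n] = suc a ℕ.* count , prism-HasCard k V n card , (begin
  ℕ→ℚ (suc a ℕ.* count)                  ≡⟨ ℕ→ℚ-* (suc a) count ⟩
  ℕ→ℚ (suc a) * ℕ→ℚ count               ≡⟨ cong₂ _*_ 1+a≡1+Kn count≡c[n] ⟩
  (1ℚ + K * n') * evalPoly c n'          ≡⟨ sym (evalPoly-mul1+KX K c n') ⟩
  evalPoly (mul1+KX K c) n'              ∎)
  where
  open ≡-Reasoning
  a : ℕ
  a = suc n ℕ.* suc k
  K n' : ℚ
  K = ℕ→ℚ (suc k)
  n' = ℕ→ℚ (suc n)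
  1+a≡1+Kn : ℕ→ℚ (suc a) ≡ 1ℚ + K * n'
  1+a≡1+Kn = trans (ℕ→ℚ-suc a) (cong (1ℚ +_) (trans (ℕ→ℚ-* (suc n) (suc k)) (ℚP.*-comm n' K)))

lemma2p3 : (e r : ℕ) → 3 ℕ.≤ e → 1 ℕ.≤ r → r ℕ.≤ e ∸ 2 →
    ExistsPolytope e r → ExistsPolytope (suc e) (suc r)
lemma2p3 e r _ 1≤r _ (N , m , V , dim , c , ehrhart , signs)
  with mul1+KX-signPattern r c 1≤r signs
... | k , largeK =
  suc N , m ℕ.+ m , prism (suc k) V , prism-dim k V dim ,
  mul1+KX (ℕ→ℚ (suc k)) c , prism-ehrhart k V c ehrhart , largeK (suc k) (ℕP.n≤1+n k)
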